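{- Let $t_0\le t_1$ be positive integers and $n$ a nonnegative integer. Let $F$ be the boolean clause-set on the variables $1,\dots,\lceil n/2\rceil$ consisting of the positive clauses $\{v : v\in H\}$ for each hyperedge $H$ of $\mathrm{pdap}(t_0,n)$ and the negative clauses $\{\bar v : v\in H\}$ for each hyperedge $H$ of $\mathrm{pdap}(t_1,n)$. Then a good palindromic partition of $\{1,\dots,n\}$ with respect to $(t_0,t_1)$ exists if and only if $F$ is satisfiable; moreover, the satisfying total assignments $f$ of $F$ are in one-to-one correspondence with the good palindromic partitions $(P_0,P_1)$ of $\{1,\dots,n\}$ with respect to $(t_0,t_1)$, via $P_\varepsilon=\{v\in\{1,\dots,n\} : f(m'_n(v))=\varepsilon\}$ for $\varepsilon\in\{0,1\}$ (false $=0$, true $=1$).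
   Context: An arithmetic progression of length $t$ is a set $\{a+id : i=0,\dots,t-1\}$ with $a,d$ positive integers. Let $\mathrm{ap}(t,n)$ be the hypergraph with vertex set $\{1,\dots,n\}$ whose hyperedges are all arithmetic progressions of length $t$ contained in $\{1,\dots,n\}$. Let $m'_n:\{1,\dots,n\}\to\{1,\dots,\lceil n/2\rceil\}$ be given by $m'_n(v)=v$ for $v\le\lceil n/2\rceil$ and $m'_n(v)=n+1-v$ otherwise. The hypergraph $\mathrm{pdap}(t,n)$ has vertex set $\{1,\dots,\lceil n/2\rceil\}$ and as hyperedges the inclusion-minimal elements of $\{m'_n(H): H \text{ a hyperedge of } \mathrm{ap}(t,n)\}$. A clause is satisfied by a total assignment $f:\{1,\dots,\lceil n/2\rceil\}\to\{0,1\}$ if some positive literal $v$ in it has $f(v)=1$ or some negative literal $\bar v$ in it has $f(v)=0$; $F$ is satisfiable if some total assignment satisfies all clauses. A good palindromic partition of $\{1,\dots,n\}$ with respect to $(t_0,t_1)$ is a pair $(P_0,P_1)$ of disjoint sets with union $\{1,\dots,n\}$, $P_0$ containing no arithmetic progression of length $t_0$, $P_1$ none of length $t_1$, and with $v\in P_i$ iff $n+1-v\in P_i$ for all $v,i$. -}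

module Defs where

open import Level using (Level; 0ℓ) renaming (suc to lsuc)
open import Data.Nat.Base using (ℕ; zero; suc; _+_; _*_; _∸_; _≤_; _<_; _≤ᵇ_; ⌈_/2⌉)
open import Data.Bool.Base using (Bool; true; false; if_then_else_)
open import Data.Product using (Σ; ∃; ∃-syntax; _×_; _,_)
open import Data.Sum using (_⊎_; inj₁; inj₂)
open import Data.Empty using (⊥)
open import Relation.Binary.PropositionalEquality using (_≡_)
open import Relation.Nullary using (¬_)
open import Function.Bundles using (_⇔_)

SetN : Set₁
SetN = ℕ → Set

_⊆_ : SetN → SetN → Set
S ⊆ T = ∀ x → S x → T x

[1,_] : ℕ → SetN
[1, n ] v = (1 ≤ v) × (v ≤ n)

AP : (t a d : ℕ) → SetN
AP t a d v = ∃[ i ] (i < t × v ≡ a + i * d)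

-- H is a hyperedge of ap(t,n): an AP of length t (a,d ≥ 1) contained in {1,…,n}.
-- (Sets are compared extensionally.)
IsAPEdge : (t n : ℕ) → SetN → Set
IsAPEdge t n H = ∃[ a ] ∃[ d ] (1 ≤ a × 1 ≤ d × AP t a d ⊆ [1, n ]
                                  × (H ⊆ AP t a d) × (AP t a d ⊆ H))

m′ : ℕ → ℕ → ℕ
m′ n v = if v ≤ᵇ ⌈ n /2⌉ then v else suc n ∸ v

image : ℕ → SetN → SetN
image n H x = ∃[ v ] (H v × m′ n v ≡ x)

IsFoldedEdge : (t n : ℕ) → SetN → Set₁
IsFoldedEdge t n S = Σ SetN λ H → IsAPEdge t n H × (S ⊆ image n H) × (image n H ⊆ S)

-- S is a hyperedge of pdap(t,n): an inclusion-minimal folded edge.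
IsPdapEdge : (t n : ℕ) → SetN → Set₁
IsPdapEdge t n S = IsFoldedEdge t n S
                 × (∀ (T : SetN) → IsFoldedEdge t n T → T ⊆ S → S ⊆ T)

data Lit : Set where
  pos : ℕ → Lit
  neg : ℕ → Lit

Clause : Set₁
Clause = Lit → Set

record ClauseSet : Set₂ where
  field
    Index  : Set₁
    clause : Index → Clause
open ClauseSet public

-- total assignment (only values on the variables 1,…,⌈n/2⌉ matter)
Assignment : Set
Assignment = ℕ → Bool

SatLit : Assignment → Lit → Set
SatLit f (pos v) = f v ≡ true
SatLit f (neg v) = f v ≡ false

SatClause : Assignment → Clause → Set
SatClause f C = ∃[ l ] (C l × SatLit f l)

Satisfies : Assignment → ClauseSet → Set₁
Satisfies f F = ∀ (i : Index F) → SatClause f (clause F i)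

Satisfiable : ClauseSet → Set₁
Satisfiable F = ∃[ f ] Satisfies f F

posClause : SetN → Clause
posClause H (pos v) = H v
posClause H (neg v) = ⊥

negClause : SetN → Clause
negClause H (pos v) = ⊥
negClause H (neg v) = H v

Fpd : (t₀ t₁ n : ℕ) → ClauseSet
Fpd t₀ t₁ n = record
  { Index  = (Σ SetN (IsPdapEdge t₀ n)) ⊎ (Σ SetN (IsPdapEdge t₁ n))
  ; clause = λ { (inj₁ (H , _)) → posClause H ; (inj₂ (H , _)) → negClause H } }

NoAP : ℕ → SetN → Set
NoAP t P = ¬ (∃[ a ] ∃[ d ] (1 ≤ a × 1 ≤ d × AP t a d ⊆ P))

GoodPalPartition : (t₀ t₁ n : ℕ) → SetN → SetN → Set
GoodPalPartition t₀ t₁ n P₀ P₁ =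
    (∀ v → P₀ v → P₁ v → ⊥)
  × (∀ v → (P₀ v ⊎ P₁ v) ⇔ [1, n ] v)
  × NoAP t₀ P₀ × NoAP t₁ P₁
  × (∀ v → [1, n ] v → (P₀ v ⇔ P₀ (suc n ∸ v)) × (P₁ v ⇔ P₁ (suc n ∸ v)))

inducedPart : ℕ → Assignment → Bool → SetN
inducedPart n f ε v = [1, n ] v × f (m′ n v) ≡ ε

-- Since m′ₙ identifies v with its mirror image n + 1 − v, total assignments on 1,…,⌈n/2⌉
-- are the same thing as palindromic 2-colourings of {1,…,n}, and the colouring induced by f
-- contains a monochromatic AP of colour ε exactly when some folded AP m′ₙ(H) is coloured ε
-- throughout. The clauses of F forbid this only for the inclusion-minimal folded APs, but
-- that suffices: every folded AP, being a finite set, contains a minimal one.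
module Submission where

open import Defs
open import Data.Nat.Base using (ℕ; zero; suc; _+_; _*_; _∸_; _≤_; _<_; _≤ᵇ_; _⊓_; ⌈_/2⌉; z≤n; s≤s; s≤s⁻¹)
open import Data.Nat.Properties
open import Data.Bool.Base using (Bool; true; false; not; T)
open import Data.Bool.Properties using (not-¬; ¬-not; not-involutive) renaming (_≟_ to _≟ᵇ_)
open import Data.Unit using (tt)
open import Data.Product using (Σ; ∃-syntax; _×_; _,_; proj₁; proj₂)
open import Data.Sum using (_⊎_; inj₁; inj₂)
open import Data.Empty using (⊥; ⊥-elim)
open import Relation.Nullary using (¬_; yes; no; contradiction)
open import Relation.Nullary.Decidable using (_×-dec_)
open import Relation.Unary using (Decidable)
open import Relation.Binary.PropositionalEquality using (_≡_; refl; sym; trans; cong; subst; module ≡-Reasoning)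
open import Function.Bundles using (_⇔_; mk⇔; Equivalence)

open Equivalence

⌈n/2⌉+⌈n/2⌉≤1+n : ∀ n → ⌈ n /2⌉ + ⌈ n /2⌉ ≤ suc n
⌈n/2⌉+⌈n/2⌉≤1+n zero = z≤n
⌈n/2⌉+⌈n/2⌉≤1+n (suc zero) = s≤s (s≤s z≤n)
⌈n/2⌉+⌈n/2⌉≤1+n (suc (suc n)) rewrite +-suc ⌈ n /2⌉ ⌈ n /2⌉ = s≤s (s≤s (⌈n/2⌉+⌈n/2⌉≤1+n n))

n≤⌈n/2⌉+⌈n/2⌉ : ∀ n → n ≤ ⌈ n /2⌉ + ⌈ n /2⌉
n≤⌈n/2⌉+⌈n/2⌉ zero = z≤n
n≤⌈n/2⌉+⌈n/2⌉ (suc zero) = s≤s z≤n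
n≤⌈n/2⌉+⌈n/2⌉ (suc (suc n)) rewrite +-suc ⌈ n /2⌉ ⌈ n /2⌉ = s≤s (s≤s (n≤⌈n/2⌉+⌈n/2⌉ n))

m′-view : ∀ n v → (v ≤ ⌈ n /2⌉ × m′ n v ≡ v) ⊎ (⌈ n /2⌉ < v × m′ n v ≡ suc n ∸ v)
m′-view n v with v ≤ᵇ ⌈ n /2⌉ in eq
... | true = inj₁ (≤ᵇ⇒≤ v _ (subst T (sym eq) tt) , refl)
... | false = inj₂ (≰⇒> (λ v≤c → subst T eq (≤⇒≤ᵇ v≤c)) , refl)

m′-fixed : ∀ {n x} → x ≤ ⌈ n /2⌉ → m′ n x ≡ x
m′-fixed {n} {x} x≤c with m′-view n x
... | inj₁ (_ , eq) = eq
... | inj₂ (c<x , _) = contradiction x≤c (<⇒≱ c<x)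

m′≡⊓ : ∀ n v → m′ n v ≡ v ⊓ (suc n ∸ v)
m′≡⊓ n v with m′-view n v
... | inj₁ (v≤c , eq) = trans eq (sym (m≤n⇒m⊓n≡m (m+n≤o⇒m≤o∸n v v+v≤1+n)))
  where
  v+v≤1+n : v + v ≤ suc n
  v+v≤1+n = ≤-trans (+-mono-≤ v≤c v≤c) (⌈n/2⌉+⌈n/2⌉≤1+n n)
... | inj₂ (c<v , eq) = trans eq (sym (m≥n⇒m⊓n≡n (m≤n+o⇒m∸n≤o (suc n) v n<v+v)))
  where
  n<v+v : n < v + v
  n<v+v = ≤-<-trans (n≤⌈n/2⌉+⌈n/2⌉ n) (+-mono-< c<v c<v)

m′-mirror : ∀ {n v} → v ≤ suc n → m′ n (suc n ∸ v) ≡ m′ n v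
m′-mirror {n} {v} v≤1+n = begin
  m′ n (suc n ∸ v)                    ≡⟨ m′≡⊓ n (suc n ∸ v) ⟩
  (suc n ∸ v) ⊓ (suc n ∸ (suc n ∸ v)) ≡⟨ cong ((suc n ∸ v) ⊓_) (m∸[m∸n]≡n v≤1+n) ⟩
  (suc n ∸ v) ⊓ v                     ≡⟨ ⊓-comm (suc n ∸ v) v ⟩
  v ⊓ (suc n ∸ v)                     ≡⟨ m′≡⊓ n v ⟨
  m′ n v                              ∎
  where open ≡-Reasoning

[1,_]? : ∀ n → Decidable [1, n ]
[1, n ]? v = (1 ≤? v) ×-dec (v ≤? n)

mirror-∈[1,n] : ∀ {n v} → [1, n ] v → [1, n ] (suc n ∸ v)
mirror-∈[1,n] {n} {suc k} (_ , 1+k≤n) = m<n⇒0<n∸m 1+k≤n , m∸n≤m n k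

m′-∈[1,n] : ∀ {n v} → [1, n ] v → [1, n ] (m′ n v)
m′-∈[1,n] {n} {v} v∈ with m′-view n v
... | inj₁ (_ , eq) rewrite eq = v∈
... | inj₂ (_ , eq) rewrite eq = mirror-∈[1,n] v∈

Palindromic : ℕ → SetN → Set
Palindromic n P = ∀ v → [1, n ] v → P v ⇔ P (suc n ∸ v)

Palindromic⇒⇔m′ : ∀ {n P} → Palindromic n P → ∀ v → [1, n ] v → P v ⇔ P (m′ n v)
Palindromic⇒⇔m′ {n} palP v v∈ with m′-view n v
... | inj₁ (_ , eq) rewrite eq = mk⇔ (λ p → p) (λ p → p)
... | inj₂ (_ , eq) rewrite eq = palP v v∈

count : {P : SetN} → Decidable P → ℕ → ℕ
count P? zero = 0
count P? (suc N) with P? N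
... | yes _ = suc (count P? N)
... | no _ = count P? N

count-mono : ∀ {P Q : SetN} (P? : Decidable P) (Q? : Decidable Q) → P ⊆ Q →
             ∀ N → count P? N ≤ count Q? N
count-mono P? Q? P⊆Q zero = z≤n
count-mono P? Q? P⊆Q (suc N) with P? N | Q? N
... | yes _  | yes _  = s≤s (count-mono P? Q? P⊆Q N)
... | yes p  | no ¬q  = contradiction (P⊆Q N p) ¬q
... | no _   | yes _  = m≤n⇒m≤1+n (count-mono P? Q? P⊆Q N)
... | no _   | no _   = count-mono P? Q? P⊆Q N

count-mono-< : ∀ {P Q : SetN} (P? : Decidable P) (Q? : Decidable Q) → P ⊆ Q →
               ∀ {N x} → x < N → Q x → ¬ P x → count P? N < count Q? N
count-mono-< P? Q? P⊆Q {suc N} {x} x<1+N qx ¬px with P? N | Q? N | m≤n⇒m<n∨m≡n (s≤s⁻¹ x<1+N)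
... | yes p | no ¬q | _ = contradiction (P⊆Q N p) ¬q
... | yes _ | yes _ | inj₁ x<N = s≤s (count-mono-< P? Q? P⊆Q x<N qx ¬px)
... | no _  | yes _ | inj₁ x<N = m<n⇒m<1+n (count-mono-< P? Q? P⊆Q x<N qx ¬px)
... | no _  | no _  | inj₁ x<N = count-mono-< P? Q? P⊆Q x<N qx ¬px
... | yes p | yes _ | inj₂ refl = contradiction p ¬px
... | no _  | yes _ | inj₂ refl = s≤s (count-mono P? Q? P⊆Q N)
... | no _  | no ¬q | inj₂ refl = contradiction qx ¬q

Minimal : (SetN → Set₁) → SetN → Set₁
Minimal Fam S = Fam S × (∀ T → Fam T → T ⊆ S → S ⊆ T)

-- Descent on the number of elements: a non-minimal member S contains a member T missing
-- some element of S, so T has fewer elements below the common bound N.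
module _ {Fam : SetN → Set₁} (dec : ∀ {S} → Fam S → Decidable S) (N : ℕ)
         (bounded : ∀ {S x} → Fam S → S x → x < N) where

  ¬¬minimal-⊆ : ∀ {S} → Fam S → ¬ ¬ (Σ SetN λ T → Minimal Fam T × T ⊆ S)
  ¬¬minimal-⊆ fS = descend (suc (count (dec fS) N)) fS ≤-refl
    where
    descend : ∀ k {S} (fS : Fam S) → count (dec fS) N < k →
              ¬ ¬ (Σ SetN λ T → Minimal Fam T × T ⊆ S)
    descend (suc k) {S} fS count<1+k ¬minimal = ¬minimal (S , (fS , minimal) , λ _ s → s)
      where
      minimal : ∀ T → Fam T → T ⊆ S → S ⊆ T
      minimal T fT T⊆S x Sx with dec fT x
      ... | yes Tx = Tx
      ... | no ¬Tx = ⊥-elim (descend k fT count<k λ (U , minU , U⊆T) →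
                               ¬minimal (U , minU , λ y Uy → T⊆S y (U⊆T y Uy)))
        where
        count<k : count (dec fT) N < k
        count<k = <-≤-trans (count-mono-< (dec fT) (dec fS) T⊆S (bounded fS Sx) Sx ¬Tx)
                            (s≤s⁻¹ count<1+k)

foldedEdge-decidable : ∀ {t n S} → IsFoldedEdge t n S → Decidable S
foldedEdge-decidable {t} {n} (H , (a , d , _ , _ , _ , H⊆AP , AP⊆H) , S⊆mH , mH⊆S) x
  with anyUpTo? (λ i → m′ n (a + i * d) ≟ x) t
... | yes (i , i<t , eq) = yes (mH⊆S x (a + i * d , AP⊆H _ (i , i<t , refl) , eq))
... | no ¬hit = no λ Sx → let (v , Hv , eq) = S⊆mH x Sx ; (i , i<t , v≡) = H⊆AP v Hv in
                  ¬hit (i , i<t , trans (cong (m′ n) (sym v≡)) eq)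

foldedEdge-≤ : ∀ {t n S x} → IsFoldedEdge t n S → S x → x ≤ n
foldedEdge-≤ {n = n} {x = x} (H , (_ , _ , _ , _ , AP⊆[1,n] , H⊆AP , _) , S⊆mH , _) Sx =
  let (v , Hv , eq) = S⊆mH x Sx in subst (_≤ n) eq (proj₂ (m′-∈[1,n] (AP⊆[1,n] v (H⊆AP v Hv))))

fold-IsFoldedEdge : ∀ {t n a d} → 1 ≤ a → 1 ≤ d → AP t a d ⊆ [1, n ] →
                    IsFoldedEdge t n (image n (AP t a d))
fold-IsFoldedEdge {t} {a = a} {d} 1≤a 1≤d AP⊆[1,n] =
  AP t a d , (a , d , 1≤a , 1≤d , AP⊆[1,n] , (λ _ v → v) , (λ _ v → v)) , (λ _ x → x) , (λ _ x → x)

HasColour : Assignment → Bool → SetN → Set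
HasColour f ε T = ∃[ v ] (T v × f v ≡ ε)

NoAP-⊆ : ∀ {t P Q} → P ⊆ Q → NoAP t Q → NoAP t P
NoAP-⊆ P⊆Q noAP (a , d , 1≤a , 1≤d , AP⊆P) = noAP (a , d , 1≤a , 1≤d , λ v p → P⊆Q v (AP⊆P v p))

pdapEdges-hasColour⇒NoAP : ∀ {t n f ε} → (∀ T → IsPdapEdge t n T → HasColour f (not ε) T) →
                           NoAP t (inducedPart n f ε)
pdapEdges-hasColour⇒NoAP {t} {n} {f} {ε} hasColour (a , d , 1≤a , 1≤d , AP⊆part) =
  ¬¬minimal-⊆ foldedEdge-decidable (suc n) (λ fS Sx → s≤s (foldedEdge-≤ fS Sx))
              (fold-IsFoldedEdge 1≤a 1≤d (λ v p → proj₁ (AP⊆part v p))) monochromatic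
  where
  monochromatic : ¬ (Σ SetN λ T → IsPdapEdge t n T × T ⊆ image n (AP t a d))
  monochromatic (T , pdapT , T⊆fold) =
    let (v , Tv , fv≡¬ε) = hasColour T pdapT ; (w , APw , m′w≡v) = T⊆fold v Tv in
    not-¬ (trans (cong f (sym m′w≡v)) (proj₂ (AP⊆part w APw))) fv≡¬ε

NoAP⇒foldedEdges-hasColour : ∀ {t n f ε} → NoAP t (inducedPart n f ε) →
                             ∀ T → IsFoldedEdge t n T → HasColour f (not ε) T
NoAP⇒foldedEdges-hasColour {t} {n} {f} {ε} noAP T (H , (a , d , 1≤a , 1≤d , AP⊆[1,n] , _ , AP⊆H) , _ , mH⊆T)
  with anyUpTo? (λ i → f (m′ n (a + i * d)) ≟ᵇ not ε) t
... | yes (i , i<t , eq) = m′ n (a + i * d) , mH⊆T _ (a + i * d , AP⊆H _ (i , i<t , refl) , refl) , eq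
... | no ¬hit = ⊥-elim (noAP (a , d , 1≤a , 1≤d , AP⊆part))
  where
  AP⊆part : AP t a d ⊆ inducedPart n f ε
  AP⊆part v (i , i<t , refl) =
    AP⊆[1,n] v (i , i<t , refl) , trans (¬-not λ eq → ¬hit (i , i<t , eq)) (not-involutive ε)

satClause-pos⇔ : ∀ {f T} → SatClause f (posClause T) ⇔ HasColour f true T
satClause-pos⇔ = mk⇔ (λ { (pos v , Tv , fv) → v , Tv , fv ; (neg _ , () , _) })
                     (λ (v , Tv , fv) → pos v , Tv , fv)

satClause-neg⇔ : ∀ {f T} → SatClause f (negClause T) ⇔ HasColour f false T
satClause-neg⇔ = mk⇔ (λ { (neg v , Tv , fv) → v , Tv , fv ; (pos _ , () , _) })
                     (λ (v , Tv , fv) → neg v , Tv , fv)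

Satisfies⇔NoAP : ∀ {t₀ t₁ n f} → Satisfies f (Fpd t₀ t₁ n) ⇔
                 (NoAP t₀ (inducedPart n f false) × NoAP t₁ (inducedPart n f true))
Satisfies⇔NoAP = mk⇔
  (λ sat → pdapEdges-hasColour⇒NoAP (λ T e → to satClause-pos⇔ (sat (inj₁ (T , e))))
         , pdapEdges-hasColour⇒NoAP (λ T e → to satClause-neg⇔ (sat (inj₂ (T , e)))))
  (λ { (noAP₀ , _) (inj₁ (T , e)) → from satClause-pos⇔ (NoAP⇒foldedEdges-hasColour noAP₀ T (proj₁ e))
     ; (_ , noAP₁) (inj₂ (T , e)) → from satClause-neg⇔ (NoAP⇒foldedEdges-hasColour noAP₁ T (proj₁ e)) })

module _ (n : ℕ) (f : Assignment) where

  inducedPart-disjoint : ∀ v → inducedPart n f false v → inducedPart n f true v → ⊥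
  inducedPart-disjoint v (_ , f≡false) (_ , f≡true) with () ← trans (sym f≡false) f≡true

  inducedPart-cover : ∀ v → (inducedPart n f false v ⊎ inducedPart n f true v) ⇔ [1, n ] v
  inducedPart-cover v = mk⇔ (λ { (inj₁ (v∈ , _)) → v∈ ; (inj₂ (v∈ , _)) → v∈ }) by-colour
    where
    by-colour : [1, n ] v → inducedPart n f false v ⊎ inducedPart n f true v
    by-colour v∈ with f (m′ n v)
    ... | false = inj₁ (v∈ , refl)
    ... | true = inj₂ (v∈ , refl)

  inducedPart-palindromic : ∀ ε → Palindromic n (inducedPart n f ε)
  inducedPart-palindromic ε v v∈@(_ , v≤n) = mk⇔
    (λ (_ , eq) → mirror-∈[1,n] v∈ , trans (cong f (m′-mirror (m≤n⇒m≤1+n v≤n))) eq)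
    (λ (_ , eq) → v∈ , trans (cong f (sym (m′-mirror (m≤n⇒m≤1+n v≤n)))) eq)

  inducedPart-good : ∀ {t₀ t₁} → NoAP t₀ (inducedPart n f false) → NoAP t₁ (inducedPart n f true) →
                     GoodPalPartition t₀ t₁ n (inducedPart n f false) (inducedPart n f true)
  inducedPart-good noAP₀ noAP₁ =
    inducedPart-disjoint , inducedPart-cover , noAP₀ , noAP₁ ,
    λ v v∈ → inducedPart-palindromic false v v∈ , inducedPart-palindromic true v v∈

  inducedPart-injective : ∀ g → (∀ ε v → inducedPart n f ε v ⇔ inducedPart n g ε v) →
                          ∀ x → 1 ≤ x → x ≤ ⌈ n /2⌉ → f x ≡ g x
  inducedPart-injective g f~g x 1≤x x≤c =
    let (_ , gx≡fx) = to (f~g (f x) x) (x∈ , cong f (m′-fixed x≤c)) in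
    sym (trans (cong g (sym (m′-fixed x≤c))) gx≡fx)
    where
    x∈ : [1, n ] x
    x∈ = 1≤x , ≤-trans x≤c (⌈n/2⌉≤n n)

module PartitionColouring {n : ℕ} {P₀ P₁ : SetN}
  (disjoint : ∀ v → P₀ v → P₁ v → ⊥)
  (cover : ∀ v → (P₀ v ⊎ P₁ v) ⇔ [1, n ] v)
  (palindromic : ∀ v → [1, n ] v → (P₀ v ⇔ P₀ (suc n ∸ v)) × (P₁ v ⇔ P₁ (suc n ∸ v)))
  where

  part : Bool → SetN
  part false = P₀
  part true = P₁

  part⊆[1,n] : ∀ ε → part ε ⊆ [1, n ]
  part⊆[1,n] false v p = to (cover v) (inj₁ p)
  part⊆[1,n] true v p = to (cover v) (inj₂ p)

  part-palindromic : ∀ ε → Palindromic n (part ε)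
  part-palindromic false v v∈ = proj₁ (palindromic v v∈)
  part-palindromic true v v∈ = proj₂ (palindromic v v∈)

  colouring : Assignment
  colouring v with [1, n ]? v
  ... | yes v∈ with from (cover v) v∈
  ...   | inj₁ _ = false
  ...   | inj₂ _ = true
  colouring v | no _ = false

  colouring-spec : ∀ ε v → [1, n ] v → part ε v ⇔ (colouring v ≡ ε)
  colouring-spec ε v v∈ with [1, n ]? v
  ... | no v∉ = contradiction v∈ v∉
  ... | yes v∈′ with from (cover v) v∈′ | ε
  ...   | inj₁ p₀ | false = mk⇔ (λ _ → refl) (λ _ → p₀)
  ...   | inj₁ p₀ | true = mk⇔ (λ p₁ → ⊥-elim (disjoint v p₀ p₁)) λ ()
  ...   | inj₂ p₁ | false = mk⇔ (λ p₀ → ⊥-elim (disjoint v p₀ p₁)) λ ()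
  ...   | inj₂ p₁ | true = mk⇔ (λ _ → refl) (λ _ → p₁)

  part⇔inducedPart : ∀ ε v → part ε v ⇔ inducedPart n colouring ε v
  part⇔inducedPart ε v = mk⇔
    (λ p → let v∈ = part⊆[1,n] ε v p in
           v∈ , to (colouring-spec ε (m′ n v) (m′-∈[1,n] v∈)) (to (part⇔part-m′ v∈) p))
    (λ (v∈ , eq) → from (part⇔part-m′ v∈) (from (colouring-spec ε (m′ n v) (m′-∈[1,n] v∈)) eq))
    where
    part⇔part-m′ : [1, n ] v → part ε v ⇔ part ε (m′ n v)
    part⇔part-m′ = Palindromic⇒⇔m′ (part-palindromic ε) v

lemma4p7 : (t₀ t₁ n : ℕ) → 1 ≤ t₀ → t₀ ≤ t₁ →
    ((Σ SetN λ P₀ → Σ SetN λ P₁ → GoodPalPartition t₀ t₁ n P₀ P₁) ⇔ Satisfiable (Fpd t₀ t₁ n))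
    × (∀ f → Satisfies f (Fpd t₀ t₁ n) →
         GoodPalPartition t₀ t₁ n (inducedPart n f false) (inducedPart n f true))
    × (∀ f g → Satisfies f (Fpd t₀ t₁ n) → Satisfies g (Fpd t₀ t₁ n) →
         (∀ ε v → inducedPart n f ε v ⇔ inducedPart n g ε v) →
         ∀ x → 1 ≤ x → x ≤ ⌈ n /2⌉ → f x ≡ g x)
    × (∀ P₀ P₁ → GoodPalPartition t₀ t₁ n P₀ P₁ →
         ∃[ f ] (Satisfies f (Fpd t₀ t₁ n)
                 × (∀ v → (P₀ v ⇔ inducedPart n f false v) × (P₁ v ⇔ inducedPart n f true v))))
-- The correspondence holds for all t₀, t₁.
lemma4p7 t₀ t₁ n _ _ =
    mk⇔ (λ (P₀ , P₁ , G) → let (f , sat , _) = surjective P₀ P₁ G in f , sat)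
        (λ (f , sat) → inducedPart n f false , inducedPart n f true , good f sat)
  , good
  , (λ f g _ _ → inducedPart-injective n f g)
  , surjective
  where
  good : ∀ f → Satisfies f (Fpd t₀ t₁ n) →
         GoodPalPartition t₀ t₁ n (inducedPart n f false) (inducedPart n f true)
  good f sat = let (noAP₀ , noAP₁) = to Satisfies⇔NoAP sat in inducedPart-good n f noAP₀ noAP₁

  surjective : ∀ P₀ P₁ → GoodPalPartition t₀ t₁ n P₀ P₁ →
               ∃[ f ] (Satisfies f (Fpd t₀ t₁ n)
                       × (∀ v → (P₀ v ⇔ inducedPart n f false v) × (P₁ v ⇔ inducedPart n f true v)))
  surjective P₀ P₁ (disjoint , cover , noAP₀ , noAP₁ , palindromic) =
    colouring ,
    from Satisfies⇔NoAP (NoAP-⊆ (λ v → from (part⇔inducedPart false v)) noAP₀ ,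
                         NoAP-⊆ (λ v → from (part⇔inducedPart true v)) noAP₁) ,
    λ v → part⇔inducedPart false v , part⇔inducedPart true v
    where open PartitionColouring disjoint cover palindromic
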